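{- Let $G$ and $H$ be two connected graphs of orders $n$ and $m\neq 1$, respectively, where $\gamma_{sp}(H)<m-1$ or $H=K_m$. Then $n(\gamma_{sp}(H)+1)\leq\gamma_{sp}(G\star H)$.
   Context: All graphs are finite, simple, undirected. $K_m$ is the complete graph on $m$ vertices. For $S\subseteq V(G)$, $\overline{S}=V(G)\setminus S$ and $N(v)$ denotes the open neighbourhood of $v$. A set $S$ is a super dominating set of $G$ if every vertex of $\overline{S}$ has a neighbour in $S$ and for every $u\in\overline{S}$ there is $v\in S$ with $N(v)\cap\overline{S}=\{u\}$. The super domination number $\gamma_{sp}(G)$ is the minimum cardinality of a super dominating set of $G$. The neighbourhood corona product $G\star H$ is the graph obtained by taking one copy of $G$ and $|V(G)|$ disjoint copies of $H$, one copy $H_w$ for each vertex $w$ of $G$, and joining every neighbour (in $G$) of $w$ to every vertex of $H_w$, for each $w\in V(G)$. -}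

module Defs where

open import Data.Nat using (ℕ; zero; suc; _+_; _*_; _<_)
open import Data.Bool using (Bool; true; false; _∧_)
open import Data.Fin using (Fin; splitAt; quotRem)
open import Data.Fin.Properties using (_≟_)
open import Data.Fin.Subset using (Subset; _∈_; _∉_; ∣_∣)
open import Data.Product using (Σ; ∃; _×_; _,_)
open import Data.Sum using (_⊎_; inj₁; inj₂)
open import Relation.Binary.PropositionalEquality using (_≡_; _≢_)
open import Relation.Nullary.Decidable using (⌊_⌋)

Graph : ℕ → Set
Graph k = Fin k → Fin k → Bool

Adj : ∀ {k} → Graph k → Fin k → Fin k → Set
Adj G u v = G u v ≡ true

IsSimple : ∀ {k} → Graph k → Set
IsSimple G = (∀ u v → G u v ≡ G v u) × (∀ v → G v v ≡ false)

data Walk {k : ℕ} (G : Graph k) : Fin k → Fin k → Set where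
  stop : ∀ {u} → Walk G u u
  step : ∀ {u w v} → Adj G u w → Walk G w v → Walk G u v

Connected : ∀ {k} → Graph k → Set
Connected {k} G = (0 < k) × (∀ u v → Walk G u v)

IsComplete : ∀ {k} → Graph k → Set
IsComplete {k} G = ∀ (u v : Fin k) → u ≢ v → Adj G u v

IsSuperDominating : ∀ {k} → Graph k → Subset k → Set
IsSuperDominating {k} G S =
  (∀ u → u ∉ S → ∃ λ v → v ∈ S × Adj G v u)
  × (∀ u → u ∉ S → ∃ λ v → v ∈ S × Adj G v u
                      × (∀ w → w ∉ S → Adj G v w → w ≡ u))

IsSuperDominationNumber : ∀ {k} → Graph k → ℕ → Set
IsSuperDominationNumber {k} G s =
  (Σ (Subset k) λ S → IsSuperDominating G S × ∣ S ∣ ≡ s)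
  × (∀ S → IsSuperDominating G S → s Data.Nat.≤ ∣ S ∣)

-- Vertices of G ⋆ H: Fin (n + n * m); the first n are the vertices of G,
-- and the remaining n*m are decoded as (w , x): vertex x of the copy H_w.
decode : ∀ n m → Fin (n + n * m) → Fin n ⊎ (Fin n × Fin m)
decode n m i with splitAt n i
... | inj₁ a = inj₁ a
... | inj₂ j with quotRem {n} m j
...   | (x , w) = inj₂ (w , x)

coronaAdj : ∀ {n m} → Graph n → Graph m → Fin n ⊎ (Fin n × Fin m) → Fin n ⊎ (Fin n × Fin m) → Bool
coronaAdj G H (inj₁ a) (inj₁ b) = G a b
coronaAdj G H (inj₁ a) (inj₂ (w , x)) = G a w
coronaAdj G H (inj₂ (w , x)) (inj₁ a) = G w a
coronaAdj G H (inj₂ (w , x)) (inj₂ (w' , y)) = ⌊ w ≟ w' ⌋ ∧ H x y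

-- Neighbourhood corona product G ⋆ H: copy of G, copies H_w of H (with H's edges),
-- and every G-neighbour a of w joined to every vertex of H_w.
_⋆_ : ∀ {n m} → Graph n → Graph m → Graph (n + n * m)
_⋆_ {n} {m} G H u v = coronaAdj G H (decode n m u) (decode n m v)

-- Let S be a super dominating set of G ⋆ H and T w the trace of S on the copy H_w. Each T w is
-- super dominating in H, so ∣ T w ∣ ≥ γ_sp(H); call w rich when the inequality is strict. A
-- vertex w ∉ S of G that is not rich (deficient) has a copy vertex (a , x) ∈ S whose only
-- neighbour outside S is w; then a ∈ S, a is rich (this is where γ_sp(H) < m - 1 or H = K_m is
-- needed) and w is the only neighbour of a outside S. So deficient vertices are matched
-- injectively to rich vertices of S (donors), each carrying a surplus of two over γ_sp(H), and
-- counting ∣ S ∣ = Σ_w ([w ∈ S] + ∣ T w ∣) gives n (γ_sp(H) + 1) ≤ ∣ S ∣.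

module Submission where

open import Defs
open import Level using (Level)
open import Data.Nat using (ℕ; zero; suc; _+_; _*_; _∸_; _≤_; _<_; z≤n; s≤s)
open import Data.Nat.Properties
open import Data.Bool using (true; if_then_else_)
import Data.Bool.Properties as Bool
open import Data.Fin using (Fin; zero; suc; _↑ˡ_; _↑ʳ_; combine; splitAt; remQuot; join; fromℕ<)
open import Data.Fin.Properties as Fin
  using (any?; all?; splitAt-↑ˡ; splitAt-↑ʳ; remQuot-combine; join-splitAt; combine-remQuot;
         ↑ˡ-injective; ↑ʳ-injective; combine-injective)
open import Data.Fin.Subset using (Subset; _∈_; _∉_; _⊆_; ∣_∣; ∁; ⁅_⁆; ⊤; inside; outside)
open import Data.Fin.Subset.Properties
  using (_∈?_; ⊆-refl; ∣∁p∣≡n∸∣p∣; ∣⁅x⁆∣≡1; ∣⊤∣≡n; p⊆q⇒∣p∣≤∣q∣; x∈∁p⇒x∉p; x∉p⇒x∈∁p; x∉∁p⇒x∈p;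
         x∈⁅x⁆; x∈⁅y⁆⇒x≡y)
open import Data.Vec using ([]; _∷_; tabulate)
open import Data.Vec.Properties using (lookup∘tabulate; []=⇒lookup; lookup⇒[]=)
open import Data.Product using (∃; _×_; _,_; proj₁; proj₂)
open import Data.Sum using (_⊎_; inj₁; inj₂; [_,_]′)
open import Function using (_∘_)
open import Relation.Nullary using (Dec; yes; no; does; ¬_; contradiction)
open import Relation.Nullary.Decidable using (_×-dec_; _→-dec_; ¬?; decidable-stable; dec-true)
open import Relation.Unary using (Pred; Decidable)
open import Relation.Binary using (REL)
import Relation.Binary as Binary
open import Relation.Binary.PropositionalEquality
open import Algebra.Properties.CommutativeMonoid.Sum +-0-commutativeMonoid
  using (sum-syntax; sum-cong-≗; ∑-comm; ∑-distrib-+)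

private variable
  a ℓ : Level
  k n m : ℕ

-- Counting with finite sums

𝟙 : {A : Set a} → Dec A → ℕ
𝟙 d = if does d then 1 else 0

𝟙-≤ : ∀ {A : Set a} {t} (d : Dec A) → (A → 1 ≤ t) → 𝟙 d ≤ t
𝟙-≤ (yes a) 1≤t = 1≤t a
𝟙-≤ (no _)  _   = z≤n

≤-𝟙 : ∀ {A : Set a} {t} (d : Dec A) → (¬ A → t ≡ 0) → (A → t ≤ 1) → t ≤ 𝟙 d
≤-𝟙 (yes a)  _   t≤1 = t≤1 a
≤-𝟙 (no ¬a) t≡0 _   = ≤-reflexive (t≡0 ¬a)

𝟙-cong : ∀ {A B : Set a} (a? : Dec A) (b? : Dec B) → (A → B) → (B → A) → 𝟙 a? ≡ 𝟙 b?
𝟙-cong (yes _) (yes _) _ _ = refl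
𝟙-cong (no _)  (no _)  _ _ = refl
𝟙-cong (yes a) (no ¬b) f _ = contradiction (f a) ¬b
𝟙-cong (no ¬a) (yes b) _ g = contradiction (g b) ¬a

∑-mono-≤ : {f g : Fin n → ℕ} → (∀ i → f i ≤ g i) → ∑[ i < n ] f i ≤ ∑[ i < n ] g i
∑-mono-≤ {zero}  f≤g = z≤n
∑-mono-≤ {suc n} f≤g = +-mono-≤ (f≤g zero) (∑-mono-≤ (f≤g ∘ suc))

∑-const : ∀ n c → ∑[ i < n ] c ≡ n * c
∑-const zero    c = refl
∑-const (suc n) c = cong (c +_) (∑-const n c)

∑-↑ : ∀ k n (f : Fin (k + n) → ℕ) →
  ∑[ i < k + n ] f i ≡ ∑[ i < k ] f (i ↑ˡ n) + ∑[ j < n ] f (k ↑ʳ j)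
∑-↑ zero    n f = refl
∑-↑ (suc k) n f = trans (cong (f zero +_) (∑-↑ k n (f ∘ suc))) (sym (+-assoc (f zero) _ _))

∑-combine : ∀ k n (f : Fin (k * n) → ℕ) →
  ∑[ i < k * n ] f i ≡ ∑[ i < k ] ∑[ j < n ] f (combine i j)
∑-combine zero    n f = refl
∑-combine (suc k) n f =
  trans (∑-↑ n (k * n) f) (cong (∑[ j < n ] f (j ↑ˡ (k * n)) +_) (∑-combine k n (f ∘ (n ↑ʳ_))))

∣p∣≡∑𝟙 : (p : Subset n) → ∣ p ∣ ≡ ∑[ i < n ] 𝟙 (i ∈? p)
∣p∣≡∑𝟙 []            = refl
∣p∣≡∑𝟙 (inside  ∷ p) = cong suc (∣p∣≡∑𝟙 p)
∣p∣≡∑𝟙 (outside ∷ p) = ∣p∣≡∑𝟙 p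

∑𝟙-witness : {P : Pred (Fin n) ℓ} (P? : Decidable P) → ∀ {i} → P i → 1 ≤ ∑[ j < n ] 𝟙 (P? j)
∑𝟙-witness P? {zero} pi with P? zero
... | yes _ = s≤s z≤n
... | no ¬p = contradiction pi ¬p
∑𝟙-witness P? {suc i} pi = ≤-trans (∑𝟙-witness (P? ∘ suc) pi) (m≤n+m _ (𝟙 (P? zero)))

∑𝟙≡0 : {P : Pred (Fin n) ℓ} (P? : Decidable P) → (∀ i → ¬ P i) → ∑[ i < n ] 𝟙 (P? i) ≡ 0
∑𝟙≡0 {zero}  P? ∄P = refl
∑𝟙≡0 {suc n} P? ∄P with P? zero
... | yes p = contradiction p (∄P zero)
... | no _  = ∑𝟙≡0 (P? ∘ suc) (∄P ∘ suc)

∑𝟙≤1 : {P : Pred (Fin n) ℓ} (P? : Decidable P) → (∀ {i j} → P i → P j → i ≡ j) →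
  ∑[ i < n ] 𝟙 (P? i) ≤ 1
∑𝟙≤1 {zero}  P? unique = z≤n
∑𝟙≤1 {suc n} P? unique with P? zero
... | yes p = ≤-reflexive (cong suc (∑𝟙≡0 (P? ∘ suc) (λ i q → Fin.0≢1+n (unique p q))))
... | no _  = ∑𝟙≤1 (P? ∘ suc) (λ p q → Fin.suc-injective (unique p q))

∑𝟙-≤-matching : {P : Pred (Fin k) ℓ} {Q : Pred (Fin n) ℓ} {R : REL (Fin k) (Fin n) ℓ} →
  (P? : Decidable P) (Q? : Decidable Q) → Binary.Decidable R →
  (∀ {i} → P i → ∃ λ j → Q j × R i j) →
  (∀ {i i′ j} → P i → P i′ → R i j → R i′ j → i ≡ i′) →
  ∑[ i < k ] 𝟙 (P? i) ≤ ∑[ j < n ] 𝟙 (Q? j)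
∑𝟙-≤-matching {k = k} {n = n} {P = P} {Q} {R} P? Q? R? match unique = begin
  ∑[ i < k ] 𝟙 (P? i)              ≤⟨ ∑-mono-≤ row ⟩
  ∑[ i < k ] ∑[ j < n ] 𝟙 (M? i j) ≡⟨ ∑-comm (λ i j → 𝟙 (M? i j)) ⟩
  ∑[ j < n ] ∑[ i < k ] 𝟙 (M? i j) ≤⟨ ∑-mono-≤ column ⟩
  ∑[ j < n ] 𝟙 (Q? j)              ∎
  where
  open ≤-Reasoning
  M? : ∀ i j → Dec (P i × Q j × R i j)
  M? i j = P? i ×-dec Q? j ×-dec R? i j
  row : ∀ i → 𝟙 (P? i) ≤ ∑[ j < n ] 𝟙 (M? i j)
  row i = 𝟙-≤ (P? i) λ pi → let j , qj , rij = match pi in ∑𝟙-witness (M? i) (pi , qj , rij)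
  column : ∀ j → ∑[ i < k ] 𝟙 (M? i j) ≤ 𝟙 (Q? j)
  column j = ≤-𝟙 (Q? j)
    (λ ¬qj → ∑𝟙≡0 (λ i → M? i j) (λ { i (_ , qj , _) → ¬qj qj }))
    (λ _ → ∑𝟙≤1 (λ i → M? i j) (λ (pi , _ , rij) (pi′ , _ , ri′j) → unique pi pi′ rij ri′j))

-- With a? deciding w ∈ S and r? deciding whether w is rich, the indicators on the left and right
-- mark donors and deficient vertices respectively.
vertex-budget : ∀ {A : Set a} {s t} (a? : Dec A) (r? : Dec (s < t)) → s ≤ t →
  𝟙 (a? ×-dec r?) + suc s ≤ 𝟙 (¬? a? ×-dec ¬? r?) + (𝟙 a? + t)
vertex-budget (yes _) (yes s<t) _   = s≤s s<t
vertex-budget (yes _) (no _)    s≤t = s≤s s≤t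
vertex-budget (no _)  (yes s<t) _   = s<t
vertex-budget (no _)  (no _)    s≤t = s≤s s≤t

-- Super dominating sets

Private : Graph k → Subset k → Fin k → Fin k → Set
Private G S v u = v ∈ S × Adj G v u × (∀ z → z ∉ S → Adj G v z → z ≡ u)

private⇒superDominating : (G : Graph k) (S : Subset k) →
  (∀ u → u ∉ S → ∃ λ v → Private G S v u) → IsSuperDominating G S
private⇒superDominating G S private-of =
  (λ u u∉S → let v , v∈S , v~u , _ = private-of u u∉S in v , v∈S , v~u) , private-of

private-neighbour-∈ : {G : Graph k} {S : Subset k} {v u z : Fin k} →
  Private G S v u → Adj G v z → z ≢ u → z ∈ S
private-neighbour-∈ {S = S} {z = z} (_ , _ , only-u) v~z z≢u =
  decidable-stable (z ∈? S) λ z∉S → z≢u (only-u z z∉S v~z)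

adj⇒≢ : {G : Graph k} → IsSimple G → ∀ {u v} → Adj G u v → u ≢ v
adj⇒≢ (_ , loopless) {u} u~u refl with () ← trans (sym u~u) (loopless u)

other-vertex : k ≢ 1 → (u : Fin k) → ∃ λ v → v ≢ u
other-vertex {suc zero}    k≢1 _       = contradiction refl k≢1
other-vertex {suc (suc _)} _   zero    = suc zero , λ ()
other-vertex {suc (suc _)} _   (suc _) = zero , λ ()

∃-neighbour : {G : Graph k} → IsSimple G → Connected G → k ≢ 1 → ∀ u → ∃ λ y → Adj G y u
∃-neighbour (symmetric , _) (_ , walk) k≢1 u with other-vertex k≢1 u
... | v , v≢u with walk u v
...   | stop               = contradiction refl v≢u
...   | step {w = y} u~y _ = y , trans (symmetric y u) u~y

∁⁅u⁆⊆⇒∉⇒≡ : {T : Subset k} {u z : Fin k} → ∁ ⁅ u ⁆ ⊆ T → z ∉ T → z ≡ u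
∁⁅u⁆⊆⇒∉⇒≡ {u = u} ∁⁅u⁆⊆T z∉T = x∈⁅y⁆⇒x≡y u (x∉∁p⇒x∈p (z∉T ∘ ∁⁅u⁆⊆T))

∁⁅u⁆⊆⇒private : {H : Graph k} {T : Subset k} {u y : Fin k} →
  IsSimple H → ∁ ⁅ u ⁆ ⊆ T → Adj H y u → Private H T y u
∁⁅u⁆⊆⇒private H-simple ∁⁅u⁆⊆T y~u =
  ∁⁅u⁆⊆T (x∉p⇒x∈∁p (adj⇒≢ H-simple y~u ∘ x∈⁅y⁆⇒x≡y _)) , y~u ,
  λ z z∉T _ → ∁⁅u⁆⊆⇒∉⇒≡ ∁⁅u⁆⊆T z∉T

∣∁⁅x⁆∣≡n∸1 : (x : Fin n) → ∣ ∁ ⁅ x ⁆ ∣ ≡ n ∸ 1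
∣∁⁅x⁆∣≡n∸1 {n} x = trans (∣∁p∣≡n∸∣p∣ ⁅ x ⁆) (cong (n ∸_) (∣⁅x⁆∣≡1 x))

∁⁅u⁆⊆⇒n∸1≤∣p∣ : {p : Subset n} {u : Fin n} → ∁ ⁅ u ⁆ ⊆ p → n ∸ 1 ≤ ∣ p ∣
∁⁅u⁆⊆⇒n∸1≤∣p∣ {p = p} {u} ∁⁅u⁆⊆p = subst (_≤ ∣ p ∣) (∣∁⁅x⁆∣≡n∸1 u) (p⊆q⇒∣p∣≤∣q∣ ∁⁅u⁆⊆p)

full⇒n≤∣p∣ : {p : Subset n} → (∀ x → x ∈ p) → n ≤ ∣ p ∣
full⇒n≤∣p∣ {n} {p} full = subst (_≤ ∣ p ∣) (∣⊤∣≡n n) (p⊆q⇒∣p∣≤∣q∣ {p = ⊤} (λ {x} _ → full x))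

∁⁅x⁆-superDominating : {H : Graph k} → IsSimple H → (∀ u → ∃ λ y → Adj H y u) →
  ∀ x → IsSuperDominating H (∁ ⁅ x ⁆)
∁⁅x⁆-superDominating {H = H} H-simple neighbour x = private⇒superDominating H (∁ ⁅ x ⁆) private-of
  where
  private-of : ∀ u → u ∉ ∁ ⁅ x ⁆ → ∃ λ y → Private H (∁ ⁅ x ⁆) y u
  private-of u u∉∁⁅x⁆ with refl ← x∈⁅y⁆⇒x≡y x (x∉∁p⇒x∈p u∉∁⁅x⁆) =
    let y , y~u = neighbour u in y , ∁⁅u⁆⊆⇒private H-simple ⊆-refl y~u

γsp<order : {H : Graph k} {s : ℕ} → IsSimple H → Connected H → k ≢ 1 →
  IsSuperDominationNumber H s → s < k
γsp<order {k} {s = s} H-simple H-connected@(0<k , _) k≢1 (_ , minimal) = begin-strict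
  s           ≤⟨ minimal _ (∁⁅x⁆-superDominating H-simple (∃-neighbour H-simple H-connected k≢1) x) ⟩
  ∣ ∁ ⁅ x ⁆ ∣ ≡⟨ ∣∁⁅x⁆∣≡n∸1 x ⟩
  k ∸ 1       <⟨ ∸-monoʳ-< (s≤s z≤n) 0<k ⟩
  k           ∎
  where
  open ≤-Reasoning
  x : Fin k
  x = fromℕ< 0<k

-- Vertices and adjacency of G ⋆ H

module CoronaVertex {n m : ℕ} where

  vG : Fin n → Fin (n + n * m)
  vG a = a ↑ˡ (n * m)

  vH : Fin n → Fin m → Fin (n + n * m)
  vH w x = n ↑ʳ combine w x

  decode-vG : ∀ a → decode n m (vG a) ≡ inj₁ a
  decode-vG a rewrite splitAt-↑ˡ n a (n * m) = refl

  decode-vH : ∀ w x → decode n m (vH w x) ≡ inj₂ (w , x)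
  decode-vH w x rewrite splitAt-↑ʳ n (n * m) (combine w x) | remQuot-combine {n} {m} w x = refl

  data View : Fin (n + n * m) → Set where
    base : ∀ a → View (vG a)
    copy : ∀ w x → View (vH w x)

  join-splitAt≡ : ∀ {i s} → splitAt n i ≡ s → join n (n * m) s ≡ i
  join-splitAt≡ {i} refl = join-splitAt n (n * m) i

  view : ∀ i → View i
  view i with splitAt n i in eq
  ... | inj₁ a = subst View (join-splitAt≡ eq) (base a)
  ... | inj₂ j = subst View (trans (cong (n ↑ʳ_) (combine-remQuot {n} m j)) (join-splitAt≡ eq))
                           (copy (proj₁ (remQuot {n} m j)) (proj₂ (remQuot {n} m j)))

  vG-injective : ∀ {a b} → vG a ≡ vG b → a ≡ b
  vG-injective = ↑ˡ-injective (n * m) _ _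

  vH-injective : ∀ {w x w′ y} → vH w x ≡ vH w′ y → w ≡ w′ × x ≡ y
  vH-injective e = combine-injective _ _ _ _ (↑ʳ-injective n _ _ e)

  vG≢vH : ∀ {a w x} → vG a ≢ vH w x
  vG≢vH {a} {w} {x} e
    with () ← trans (sym (decode-vG a)) (trans (cong (decode n m) e) (decode-vH w x))

  module Adjacency (G : Graph n) (H : Graph m) where

    ⋆-GG : ∀ {a b} → (G ⋆ H) (vG a) (vG b) ≡ G a b
    ⋆-GG {a} {b} rewrite decode-vG a | decode-vG b = refl

    ⋆-GH : ∀ {a w x} → (G ⋆ H) (vG a) (vH w x) ≡ G a w
    ⋆-GH {a} {w} {x} rewrite decode-vG a | decode-vH w x = refl

    ⋆-HG : ∀ {w x a} → (G ⋆ H) (vH w x) (vG a) ≡ G w a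
    ⋆-HG {w} {x} {a} rewrite decode-vG a | decode-vH w x = refl

    ⋆-HH-same : ∀ {w x y} → (G ⋆ H) (vH w x) (vH w y) ≡ H x y
    ⋆-HH-same {w} {x} {y} rewrite decode-vH w x | decode-vH w y with w Fin.≟ w
    ... | yes _   = refl
    ... | no w≢w = contradiction refl w≢w

    ⋆-HH-adj : ∀ {w x w′ y} → Adj (G ⋆ H) (vH w x) (vH w′ y) → w ≡ w′ × Adj H x y
    ⋆-HH-adj {w} {x} {w′} {y} x~y rewrite decode-vH w x | decode-vH w′ y with w Fin.≟ w′
    ... | yes w≡w′ = w≡w′ , x~y

-- A super dominating set of G ⋆ H

module SuperDominatingCorona
  {n m} {G : Graph n} {H : Graph m} (G-simple : IsSimple G) (H-simple : IsSimple H)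
  (H-neighbour : ∀ u → ∃ λ y → Adj H y u)
  (S : Subset (n + n * m)) (S-private : ∀ u → u ∉ S → ∃ λ v → Private (G ⋆ H) S v u)
  where

  open CoronaVertex {n} {m}
  open Adjacency G H

  private-∈ : ∀ {v u z} → Private (G ⋆ H) S v u → Adj (G ⋆ H) v z → z ≢ u → z ∈ S
  private-∈ = private-neighbour-∈ {G = G ⋆ H}

  T : Fin n → Subset m
  T w = tabulate (λ x → does (vH w x ∈? S))

  ∈T⁺ : ∀ {w x} → vH w x ∈ S → x ∈ T w
  ∈T⁺ {w} {x} ∈S = lookup⇒[]= x (T w) (trans (lookup∘tabulate _ x) (dec-true (vH w x ∈? S) ∈S))

  ∈T⁻ : ∀ {w x} → x ∈ T w → vH w x ∈ S
  ∈T⁻ {w} {x} x∈T with vH w x ∈? S | trans (sym (lookup∘tabulate _ x)) ([]=⇒lookup x∈T)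
  ... | yes ∈S | _ = ∈S

  ∣T∣≡∑𝟙 : ∀ w → ∣ T w ∣ ≡ ∑[ x < m ] 𝟙 (vH w x ∈? S)
  ∣T∣≡∑𝟙 w = trans (∣p∣≡∑𝟙 (T w)) (sum-cong-≗ λ x → 𝟙-cong (x ∈? T w) (vH w x ∈? S) ∈T⁻ ∈T⁺)

  ∣S∣≡∑ : ∣ S ∣ ≡ ∑[ w < n ] (𝟙 (vG w ∈? S) + ∣ T w ∣)
  ∣S∣≡∑ = begin
    ∣ S ∣                                          ≡⟨ ∣p∣≡∑𝟙 S ⟩
    ∑[ i < n + n * m ] 𝟙 (i ∈? S)                  ≡⟨ ∑-↑ n (n * m) _ ⟩
    ∑base + ∑[ j < n * m ] 𝟙 (n ↑ʳ j ∈? S)        ≡⟨ cong (∑base +_) (∑-combine n m _) ⟩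
    ∑base + ∑[ w < n ] ∑[ x < m ] 𝟙 (vH w x ∈? S) ≡⟨ cong (∑base +_) (sum-cong-≗ (sym ∘ ∣T∣≡∑𝟙)) ⟩
    ∑base + ∑[ w < n ] ∣ T w ∣                     ≡⟨ ∑-distrib-+ (λ w → 𝟙 (vG w ∈? S)) (∣_∣ ∘ T) ⟨
    ∑[ w < n ] (𝟙 (vG w ∈? S) + ∣ T w ∣)           ∎
    where
    open ≡-Reasoning
    ∑base : ℕ
    ∑base = ∑[ w < n ] 𝟙 (vG w ∈? S)

  private-of-copy : ∀ {w u} → vH w u ∉ S →
    (∃ λ q → Private (G ⋆ H) S (vG q) (vH w u)) ⊎ (∃ λ x → Private (G ⋆ H) S (vH w x) (vH w u))
  private-of-copy u∉S with S-private _ u∉S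
  ... | v , pv with view v
  ...   | base q   = inj₁ (q , pv)
  ...   | copy _ x with refl , _ ← ⋆-HH-adj (proj₁ (proj₂ pv)) = inj₂ (x , pv)

  base-private⇒∁⁅u⁆⊆T : ∀ {q w u} → Private (G ⋆ H) S (vG q) (vH w u) → ∁ ⁅ u ⁆ ⊆ T w
  base-private⇒∁⁅u⁆⊆T {u = u} pq@(_ , q~u , _) {y} y∈∁⁅u⁆ = ∈T⁺ (private-∈ pq
    (trans ⋆-GH (trans (sym ⋆-GH) q~u))
    (λ y≡u → x∈∁p⇒x∉p y∈∁⁅u⁆ (subst (_∈ ⁅ u ⁆) (sym (proj₂ (vH-injective y≡u))) (x∈⁅x⁆ u))))

  base-private⇒base∈S : ∀ {q w u} → Private (G ⋆ H) S (vG q) (vH w u) → vG w ∈ S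
  base-private⇒base∈S pq@(_ , q~u , _) = private-∈ pq (trans ⋆-GG (trans (sym ⋆-GH) q~u)) vG≢vH

  copy-superDominating : ∀ w → IsSuperDominating H (T w)
  copy-superDominating w = private⇒superDominating H (T w) private-of
    where
    private-of : ∀ u → u ∉ T w → ∃ λ y → Private H (T w) y u
    private-of u u∉T with private-of-copy (u∉T ∘ ∈T⁺)
    ... | inj₁ (_ , pq) = let y , y~u = H-neighbour u in
      y , ∁⁅u⁆⊆⇒private H-simple (base-private⇒∁⁅u⁆⊆T pq) y~u
    ... | inj₂ (x , x∈S , x~u , only-u) = x , ∈T⁺ x∈S , trans (sym ⋆-HH-same) x~u ,
      λ z z∉T x~z → proj₂ (vH-injective (only-u (vH w z) (z∉T ∘ ∈T⁺) (trans ⋆-HH-same x~z)))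

  module _ {sH : ℕ} (H-γsp : IsSuperDominationNumber H sH) (sH<m : sH < m)
           (H-sparse-or-complete : sH < m ∸ 1 ⊎ IsComplete H) where

    Rich : Fin n → Set
    Rich w = sH < ∣ T w ∣

    Donor : Fin n → Set
    Donor a = vG a ∈ S × Rich a

    Deficient : Fin n → Set
    Deficient w = vG w ∉ S × ¬ Rich w

    Matched : Fin n → Fin n → Set
    Matched w a = Adj G a w × (∀ b → vG b ∉ S → Adj G a b → b ≡ w)

    Rich? : Decidable Rich
    Rich? w = sH <? ∣ T w ∣

    Donor? : Decidable Donor
    Donor? a = vG a ∈? S ×-dec Rich? a

    Deficient? : Decidable Deficient
    Deficient? w = ¬? (vG w ∈? S) ×-dec ¬? (Rich? w)

    Matched? : Binary.Decidable Matched
    Matched? w a = G a w Bool.≟ true ×-dec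
      all? (λ b → ¬? (vG b ∈? S) →-dec G a b Bool.≟ true →-dec b Fin.≟ w)

    rich-or-missing : ∀ w → Rich w ⊎ ∃ λ u → vH w u ∉ S
    rich-or-missing w with any? (λ u → ¬? (vH w u ∈? S))
    ... | yes missing = inj₂ missing
    ... | no  none    = inj₁ (<-≤-trans sH<m (full⇒n≤∣p∣ λ x →
      ∈T⁺ (decidable-stable (vH w x ∈? S) (λ x∉S → none (x , x∉S)))))

    copy-private⇒rich : ∀ {w a x} → vG w ∉ S → Private (G ⋆ H) S (vH a x) (vG w) → Rich a
    copy-private⇒rich {w} {a} {x} w∉S (x∈S , x~w , only-w) with rich-or-missing a
    ... | inj₁ rich = rich
    ... | inj₂ (y , y∉S) with private-of-copy y∉S
    ...   | inj₂ (_ , _ , _ , only-y) =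
      contradiction (only-y (vG w) w∉S (trans ⋆-HG (trans (sym ⋆-HG) x~w))) vG≢vH
    ...   | inj₁ (_ , pq) = [ sparse , complete ]′ H-sparse-or-complete
      where
      sparse : sH < m ∸ 1 → Rich a
      sparse sH<m∸1 = <-≤-trans sH<m∸1 (∁⁅u⁆⊆⇒n∸1≤∣p∣ (base-private⇒∁⁅u⁆⊆T pq))
      complete : IsComplete H → Rich a
      complete H-complete = contradiction
        (only-w (vH a y) y∉S (trans ⋆-HH-same (H-complete x y λ { refl → y∉S x∈S }))) (vG≢vH ∘ sym)

    deficient⇒matched : ∀ {w} → Deficient w → ∃ λ a → Donor a × Matched w a
    deficient⇒matched {w} (w∉S , ¬rich) with rich-or-missing w | S-private (vG w) w∉S
    ... | inj₁ rich      | _ = contradiction rich ¬rich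
    ... | inj₂ (u , u∉S) | v , pv@(_ , v~w , only-w) with view v
    ...   | base a =
      contradiction (only-w (vH w u) u∉S (trans ⋆-GH (trans (sym ⋆-GG) v~w))) (vG≢vH ∘ sym)
    ...   | copy a x = a , (a∈S , copy-private⇒rich w∉S pv) , a~w ,
      λ b b∉S a~b → vG-injective (only-w (vG b) b∉S (trans ⋆-HG a~b))
      where
      a~w : Adj G a w
      a~w = trans (sym ⋆-HG) v~w
      a∈S : vG a ∈ S
      a∈S with private-of-copy u∉S
      ... | inj₁ (_ , pq) = contradiction (base-private⇒base∈S pq) w∉S
      ... | inj₂ (_ , pq) = private-∈ pq (trans ⋆-HG (trans (proj₁ G-simple w a) a~w)) vG≢vH

    matched-unique : ∀ {w w′ a} → Deficient w → Deficient w′ → Matched w a → Matched w′ a → w ≡ w′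
    matched-unique _ (w′∉S , _) (_ , only-w) (a~w′ , _) = sym (only-w _ w′∉S a~w′)

    n*[sH+1]≤∣S∣ : n * (sH + 1) ≤ ∣ S ∣
    n*[sH+1]≤∣S∣ = +-cancelˡ-≤ #donors _ _ (begin
      #donors + n * (sH + 1)                              ≡⟨ cong (#donors +_) n*[sH+1]≡∑ ⟩
      #donors + ∑[ w < n ] suc sH                         ≡⟨ ∑-distrib-+ (𝟙 ∘ Donor?) (λ _ → suc sH) ⟨
      ∑[ w < n ] (𝟙 (Donor? w) + suc sH)                  ≤⟨ ∑-mono-≤ budget ⟩
      ∑[ w < n ] (𝟙 (Deficient? w) + weight w)            ≡⟨ ∑-distrib-+ (𝟙 ∘ Deficient?) weight ⟩
      ∑[ w < n ] 𝟙 (Deficient? w) + ∑[ w < n ] weight w  ≤⟨ +-monoˡ-≤ _ deficient≤donors ⟩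
      #donors + ∑[ w < n ] weight w                       ≡⟨ cong (#donors +_) ∣S∣≡∑ ⟨
      #donors + ∣ S ∣                                     ∎)
      where
      open ≤-Reasoning
      n*[sH+1]≡∑ : n * (sH + 1) ≡ ∑[ w < n ] suc sH
      n*[sH+1]≡∑ = trans (cong (n *_) (+-comm sH 1)) (sym (∑-const n (suc sH)))
      #donors : ℕ
      #donors = ∑[ a < n ] 𝟙 (Donor? a)
      weight : Fin n → ℕ
      weight w = 𝟙 (vG w ∈? S) + ∣ T w ∣
      budget : ∀ w → 𝟙 (Donor? w) + suc sH ≤ 𝟙 (Deficient? w) + weight w
      budget w = vertex-budget (vG w ∈? S) (Rich? w) (proj₂ H-γsp (T w) (copy-superDominating w))
      deficient≤donors : ∑[ w < n ] 𝟙 (Deficient? w) ≤ #donors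
      deficient≤donors = ∑𝟙-≤-matching Deficient? Donor? Matched? deficient⇒matched matched-unique

theorem3p3 : ∀ {n m} (G : Graph n) (H : Graph m) (sH sGH : ℕ) →
    IsSimple G → IsSimple H → Connected G → Connected H → m ≢ 1 →
    (sH < m ∸ 1 ⊎ IsComplete H) →
    IsSuperDominationNumber H sH → IsSuperDominationNumber (G ⋆ H) sGH →
    n * (sH + 1) ≤ sGH
-- G need not be connected.
theorem3p3 {n} G H sH sGH G-simple H-simple _ H-connected m≢1 sparse-or-complete H-γsp
  ((S , (_ , S-private) , ∣S∣≡sGH) , _) =
  subst (n * (sH + 1) ≤_) ∣S∣≡sGH
    (SuperDominatingCorona.n*[sH+1]≤∣S∣ G-simple H-simple (∃-neighbour H-simple H-connected m≢1)
      S S-private H-γsp (γsp<order H-simple H-connected m≢1 H-γsp) sparse-or-complete)
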